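{- Let $G$ be a finite abelian group. Then $[D(G)+1,\ \min\{2\exp(G)+1,\ \eta(G)-1\}]\subset C_0(G)$.
   Context: $[a,b]=\{x\in\mathbb Z:a\le x\le b\}$ (empty if $a>b$). A sequence over $G$ is a finite unordered list of elements of $G$ with repetition allowed; length counts multiplicity. A short zero-sum sequence is a sequence with sum $0$ and length in $[1,\exp(G)]$. $D(G)$ is the smallest $d$ such that every sequence over $G$ of length $\ge d$ has a nonempty zero-sum subsequence; $\eta(G)$ is the smallest $d$ such that every sequence of length $\ge d$ has a short zero-sum subsequence. $C_0(G)$ is the set of integers $t\in[D(G)+1,\eta(G)-1]$ such that every zero-sum sequence over $G$ of length exactly $t$ contains a short zero-sum subsequence. -}

module Defs where

open import Level using (_⊔_)
open import Algebra.Bundles using (AbelianGroup)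
open import Data.Nat using (ℕ; zero; suc; _+_; _*_; _≤_; _<_)
open import Data.Fin using (Fin)
open import Data.List using (List; foldr; length)
open import Data.List.Relation.Binary.Sublist.Propositional using (_⊆_)
open import Data.Product using (_×_; Σ; ∃)
open import Relation.Binary.PropositionalEquality using (_≡_)

module _ {c ℓ : Level.Level} (G : AbelianGroup c ℓ) where
  open AbelianGroup G

  IsFinite : Set (c ⊔ ℓ)
  IsFinite = Σ ℕ λ n → Σ (Fin n → Carrier) λ enum → ∀ x → Σ (Fin n) λ i → enum i ≈ x

  mulℕ : ℕ → Carrier → Carrier
  mulℕ zero g = ε
  mulℕ (suc n) g = g ∙ mulℕ n g

  -- sum of a sequence (a list; order is irrelevant since G is abelian)
  σ : List Carrier → Carrier
  σ = foldr _∙_ ε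

  ZeroSum : List Carrier → Set ℓ
  ZeroSum S = σ S ≈ ε

  HasZeroSumSub : List Carrier → Set (c ⊔ ℓ)
  HasZeroSumSub S = Σ (List Carrier) λ T → T ⊆ S × 1 ≤ length T × ZeroSum T

  HasShortZeroSumSub : ℕ → List Carrier → Set (c ⊔ ℓ)
  HasShortZeroSumSub e S = Σ (List Carrier) λ T → T ⊆ S × 1 ≤ length T × length T ≤ e × ZeroSum T

  IsExp : ℕ → Set (c ⊔ ℓ)
  IsExp e = 1 ≤ e × (∀ g → mulℕ e g ≈ ε)
          × (∀ m → 1 ≤ m → (∀ g → mulℕ m g ≈ ε) → e ≤ m)

  DavenportProp : ℕ → Set (c ⊔ ℓ)
  DavenportProp d = ∀ S → d ≤ length S → HasZeroSumSub S

  IsDavenport : ℕ → Set (c ⊔ ℓ)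
  IsDavenport d = DavenportProp d × (∀ d' → DavenportProp d' → d ≤ d')

  EtaProp : ℕ → ℕ → Set (c ⊔ ℓ)
  EtaProp e d = ∀ S → d ≤ length S → HasShortZeroSumSub e S

  IsEta : ℕ → ℕ → Set (c ⊔ ℓ)
  IsEta e η = EtaProp e η × (∀ d' → EtaProp e d' → η ≤ d')

  -- t ∈ C₀(G), given D = D(G), e = exp(G), η = η(G);  t ≤ η - 1 written t < η
  InC0 : ℕ → ℕ → ℕ → ℕ → Set (c ⊔ ℓ)
  InC0 D e η t = D + 1 ≤ t × t < η
               × (∀ S → length S ≡ t → ZeroSum S → HasShortZeroSumSub e S)

{-# OPTIONS --safe #-}
module Submission where

-- Drop one element x from a zero-sum sequence S with D(G) < |S| ≤ 2 exp(G) + 1. The rest still has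
-- length ≥ D(G), so it contains a nonempty zero-sum T. If T is not short, then |T| > exp(G), and the
-- complement of T in S, which contains x and is zero-sum because S and T are, has length ≤ exp(G).

open import Defs
open import Level using (Level)
open import Algebra.Bundles using (AbelianGroup)
open import Data.Nat using (ℕ; suc; _+_; _*_; _≤_; _<_; s≤s; _≤?_)
open import Data.Nat.Properties
open import Data.List using (List; []; _∷_; length)
open import Data.List.Relation.Binary.Sublist.Propositional using (_⊆_; []; _∷_; _∷ʳ_)
open import Data.List.Relation.Binary.Sublist.Propositional.Properties using (length-mono-≤)
open import Data.Product using (Σ; _×_; _,_)
open import Relation.Binary.PropositionalEquality as ≡ using (_≡_)
open import Relation.Nullary using (yes; no)
import Relation.Binary.Reasoning.Setoid as SetoidReasoning

m≤n⇒1+n≡m+o⇒0<o : ∀ {m n o} → m ≤ n → suc n ≡ m + o → 0 < o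
m≤n⇒1+n≡m+o⇒0<o {m} {n} {o} m≤n eq = +-cancelˡ-< m 0 o (begin-strict
  m + 0 ≡⟨ +-identityʳ m ⟩
  m     ≤⟨ m≤n ⟩
  n     <⟨ n<1+n n ⟩
  suc n ≡⟨ eq ⟩
  m + o ∎)
  where open ≤-Reasoning

m+n≤2o+1⇒o<m⇒n≤o : ∀ {m n o} → m + n ≤ 2 * o + 1 → o < m → n ≤ o
m+n≤2o+1⇒o<m⇒n≤o {m} {n} {o} m+n≤ o<m = +-cancelˡ-≤ o n o (≤-pred (begin
  suc o + n     ≤⟨ +-monoˡ-≤ n o<m ⟩
  m + n         ≤⟨ m+n≤ ⟩
  2 * o + 1     ≡⟨ +-comm (2 * o) 1 ⟩
  suc (2 * o)   ≡⟨ ≡.cong (λ k → suc (o + k)) (+-identityʳ o) ⟩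
  suc (o + o)   ∎))
  where open ≤-Reasoning

module _ {c ℓ : Level} (G : AbelianGroup c ℓ) where
  open AbelianGroup G
  open import Algebra.Properties.CommutativeSemigroup commutativeSemigroup using (x∙yz≈y∙xz)
  open SetoidReasoning setoid

  ⊆-complement : ∀ {T S : List Carrier} → T ⊆ S →
    Σ (List Carrier) λ C → C ⊆ S × length S ≡ length T + length C × σ G S ≈ σ G T ∙ σ G C
  ⊆-complement [] = [] , [] , ≡.refl , sym (identityˡ ε)
  ⊆-complement {T} (y ∷ʳ T⊆S) with ⊆-complement T⊆S
  ... | C , C⊆S , |S|≡ , σS≈ =
    y ∷ C , ≡.refl ∷ C⊆S ,
    ≡.trans (≡.cong suc |S|≡) (≡.sym (+-suc (length T) (length C))) ,
    trans (∙-congˡ σS≈) (x∙yz≈y∙xz y (σ G T) (σ G C))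
  ⊆-complement (≡.refl ∷ T⊆S) with ⊆-complement T⊆S
  ... | C , C⊆S , |S|≡ , σS≈ =
    C , _ ∷ʳ C⊆S , ≡.cong suc |S|≡ , trans (∙-congˡ σS≈) (sym (assoc _ _ _))

  zeroSum-complement : ∀ {T S : List Carrier} → T ⊆ S → ZeroSum G S → ZeroSum G T →
    Σ (List Carrier) λ C → C ⊆ S × length S ≡ length T + length C × ZeroSum G C
  zeroSum-complement {T} {S} T⊆S zS zT with ⊆-complement T⊆S
  ... | C , C⊆S , |S|≡ , σS≈ = C , C⊆S , |S|≡ , (begin
    σ G C           ≈⟨ sym (identityˡ (σ G C)) ⟩
    ε ∙ σ G C       ≈⟨ ∙-congʳ (sym zT) ⟩
    σ G T ∙ σ G C   ≈⟨ sym σS≈ ⟩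
    σ G S           ≈⟨ zS ⟩
    ε               ∎)

  zeroSum⇒hasShortZeroSumSub : ∀ {D e} → DavenportProp G D →
    ∀ S → D < length S → length S ≤ 2 * e + 1 → ZeroSum G S → HasShortZeroSumSub G e S
  zeroSum⇒hasShortZeroSumSub {e = e} davenport (x ∷ xs) (s≤s D≤|xs|) |S|≤ zS
    with davenport xs D≤|xs|
  ... | T , T⊆xs , 0<|T| , zT with length T ≤? e
  ... | yes |T|≤e = T , x ∷ʳ T⊆xs , 0<|T| , |T|≤e , zT
  ... | no |T|≰e with zeroSum-complement (x ∷ʳ T⊆xs) zS zT
  ... | C , C⊆S , |S|≡ , zC =
    C , C⊆S ,
    m≤n⇒1+n≡m+o⇒0<o (length-mono-≤ T⊆xs) |S|≡ ,
    m+n≤2o+1⇒o<m⇒n≤o (≡.subst (_≤ 2 * e + 1) |S|≡ |S|≤) (≰⇒> |T|≰e) ,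
    zC

lemma5p4 : ∀ {c ℓ : Level} (G : AbelianGroup c ℓ) → IsFinite G →
    (D e η : ℕ) → IsDavenport G D → IsExp G e → IsEta G e η →
    (t : ℕ) → D + 1 ≤ t → t ≤ 2 * e + 1 → t < η →
    InC0 G D e η t
lemma5p4 G _ D e η (davenport , _) _ _ t D+1≤t t≤2e+1 t<η =
  D+1≤t , t<η , λ S |S|≡t zS →
    zeroSum⇒hasShortZeroSumSub G davenport S
      (≡.subst (D <_) (≡.sym |S|≡t) (≡.subst (_≤ t) (+-comm D 1) D+1≤t))
      (≡.subst (_≤ 2 * e + 1) (≡.sym |S|≡t) t≤2e+1)
      zS
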